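{- Let $\Gamma,\Delta$ be finite sets of formulas in $For_1$ with $\Gamma\cup\Delta$ nonempty. If the sequent $\Gamma\Rightarrow\Delta$ is provable in $\mathbf{H}$, then there is a derivation of it in $\mathbf{H}$ that does not use the Cut rule.
   Context: Fix a denumerable set $prop$ of propositional variables. $For_1$ is the set of formulas built from $prop$ with a unary connective $\lnot$ and a binary connective $\vee$. $var(\alpha)$ is the set of propositional variables in $\alpha$; $var(\Delta)=\bigcup_{\delta\in\Delta}var(\delta)$. A sequent $\Gamma\Rightarrow\Delta$ is an ordered pair of finite sets of formulas, not both empty; $\alpha,\Gamma$ denotes $\Gamma\cup\{\alpha\}$. The calculus $\mathbf{H}$ has the axiom $\alpha\Rightarrow\alpha$ and the rules (premises / conclusion): (W$\Rightarrow$) $\Gamma\Rightarrow\Delta$ / $\alpha,\Gamma\Rightarrow\Delta$; ($\Rightarrow$W) $\Gamma\Rightarrow\Delta$ / $\Gamma\Rightarrow\Delta,\alpha$; (Cut) $\Gamma\Rightarrow\Delta,\alpha$ and $\alpha,\Gamma\Rightarrow\Delta$ / $\Gamma\Rightarrow\Delta$; ($\Rightarrow\lnot$) $\alpha,\Gamma\Rightarrow\Delta$ / $\Gamma\Rightarrow\Delta,\lnot\alpha$; ($\lnot^H\Rightarrow$) $\Gamma\Rightarrow\Delta,\alpha$ / $\lnot\alpha,\Gamma\Rightarrow\Delta$, allowed only if $var(\alpha)\subseteq var(\Delta)$; ($\vee\Rightarrow$) $\alpha_1,\Gamma\Rightarrow\Delta$ and $\alpha_2,\Gamma\Rightarrow\Delta$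 / $\alpha_1\vee\alpha_2,\Gamma\Rightarrow\Delta$; ($\Rightarrow\vee$) $\Gamma\Rightarrow\Delta,\alpha_1,\alpha_2$ / $\Gamma\Rightarrow\Delta,\alpha_1\vee\alpha_2$. -}

module Defs where

open import Data.Nat using (ℕ)
open import Data.Bool using (Bool; true; false)
open import Data.List using (List; []; _∷_; _++_; concatMap)
open import Data.List.Relation.Binary.Subset.Propositional using (_⊆_)
open import Data.Product using (_×_)
open import Data.Sum using (_⊎_)
open import Data.Empty using (⊥)
open import Relation.Binary.PropositionalEquality using (_≡_)
open import Relation.Nullary using (¬_)

data For₁ : Set where
  pv   : ℕ → For₁
  ¬′_  : For₁ → For₁
  _∨′_ : For₁ → For₁ → For₁

infix  30 ¬′_
infixl 20 _∨′_

-- var(α): the propositional variables of α (as a list; used only via membership)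
var : For₁ → List ℕ
var (pv p)    = p ∷ []
var (¬′ α)    = var α
var (α ∨′ β)  = var α ++ var β

varSet : List For₁ → List ℕ
varSet = concatMap var

-- Finite sets of formulas are represented by lists, read as the set of their
-- elements; two lists denote the same finite set iff they have the same members.
_≐_ : List For₁ → List For₁ → Set
Γ ≐ Γ′ = (Γ ⊆ Γ′) × (Γ′ ⊆ Γ)

NonEmptySeq : List For₁ → List For₁ → Set
NonEmptySeq Γ Δ = ¬ ((Γ ≡ []) × (Δ ≡ []))

-- The index c says whether Cut may be used:
-- H c Γ Δ  is a derivation of Γ ⇒ Δ; with c = true all rules of H are
-- available, with c = false Cut is unavailable (cut-free derivations).
-- α,Γ (i.e. Γ ∪ {α}) is written α ∷ Γ and Δ,α is written α ∷ Δ; the rule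
-- `reprₛ` expresses that sequents are pairs of *sets*, so list representations
-- with the same members denote the same sequent.
data H (c : Bool) : List For₁ → List For₁ → Set where
  ax    : ∀ α → H c (α ∷ []) (α ∷ [])
  reprₛ : ∀ {Γ Δ Γ′ Δ′} → Γ ≐ Γ′ → Δ ≐ Δ′ → H c Γ Δ → H c Γ′ Δ′
  W⇒    : ∀ {Γ Δ} α → H c Γ Δ → H c (α ∷ Γ) Δ
  ⇒W    : ∀ {Γ Δ} α → H c Γ Δ → H c Γ (α ∷ Δ)
  cut   : ∀ {Γ Δ} α → c ≡ true → NonEmptySeq Γ Δ →
          H c Γ (α ∷ Δ) → H c (α ∷ Γ) Δ → H c Γ Δ
  ⇒¬    : ∀ {Γ Δ} α → H c (α ∷ Γ) Δ → H c Γ (¬′ α ∷ Δ)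
  ¬H⇒   : ∀ {Γ Δ} α → var α ⊆ varSet Δ → H c Γ (α ∷ Δ) → H c (¬′ α ∷ Γ) Δ
  ∨⇒    : ∀ {Γ Δ} α₁ α₂ → H c (α₁ ∷ Γ) Δ → H c (α₂ ∷ Γ) Δ → H c (α₁ ∨′ α₂ ∷ Γ) Δ
  ⇒∨    : ∀ {Γ Δ} α₁ α₂ → H c Γ (α₁ ∷ α₂ ∷ Δ) → H c Γ (α₁ ∨′ α₂ ∷ Δ)

Provable : List For₁ → List For₁ → Set
Provable = H true

CutFree : List For₁ → List For₁ → Set
CutFree = H false

module Submission where

-- 1. Soundness: every rule of H (Cut included) preserves validity in the
--    paraconsistent weak Kleene logic PWK, whose third value "undefined" is
--    designated and infectious.  The variable condition on (¬H⇒) is exactly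
--    what makes that rule sound when the negated formula is undefined.
-- 2. Restriction: if Γ ⇒ Δ is PWK-valid, then Γ′ ⇒ Δ is classically valid,
--    where Γ′ keeps the formulas of Γ whose variables all occur in Δ
--    (valuate the variables outside var(Δ) as undefined).
-- 3. Completeness: a classically valid Γ′ ⇒ Δ with var(Γ′) ⊆ var(Δ) has a
--    cut-free derivation, and so has every Γ ⇒ Δ with Γ′ ⊆ Γ.  Proof search
--    decomposes the compound formulas, keeping each principal formula in the
--    sequent (sequents are sets), so the variable condition of (¬H⇒) is kept.

open import Defs
open import Data.Bool using (Bool; true; false; not; _∨_; T)
open import Data.Bool.Properties using (T-∨)
open import Data.Empty using (⊥-elim)
open import Data.List using (List; []; _∷_; _++_; map; filter)
open import Data.List.Properties using (++-identityʳ)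
open import Data.List.Membership.Propositional using (_∈_; _∉_; find; lose)
open import Data.List.Membership.Propositional.Properties
  using (∈-++⁺ˡ; ∈-++⁺ʳ; ∈-++⁻; ∈-map⁺; ∈-concatMap⁺)
import Data.List.Membership.DecPropositional as DecMembership
open import Data.List.Relation.Binary.Subset.Propositional using (_⊆_)
open import Data.List.Relation.Binary.Subset.Propositional.Properties
  using (⊆-refl; ⊆-reflexive; ⊆-reflexive-↭; Any-resp-⊆; All-resp-⊇; ∷⁺ʳ; ∈-∷⁺ʳ;
         xs⊆xs++ys; xs⊆ys++xs; ++⁺ˡ; filter-⊆)
open import Data.List.Relation.Binary.Permutation.Propositional using (↭-sym)
open import Data.List.Relation.Binary.Permutation.Propositional.Properties using (shift)
open import Data.List.Relation.Unary.All as All using (All; []; _∷_; all?)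
import Data.List.Relation.Unary.All.Properties as AllP
open import Data.List.Relation.Unary.Any as Any using (Any; here; there)
import Data.List.Relation.Unary.Any.Properties as AnyP
open import Data.Maybe using (Maybe; just; nothing)
open import Data.Nat using (ℕ; zero; suc; _+_; _≤_; _<_; s≤s)
open import Data.Nat.Properties
  using (≤-refl; ≤-reflexive; ≤-<-trans; +-assoc; +-comm; +-identityʳ;
         m≤m+n; m≤n+m; +-monoˡ-≤; _≟_)
open import Data.Product using (_×_; _,_; ∃-syntax)
open import Data.Sum using (_⊎_; inj₁; inj₂; [_,_]; [_,_]′)
open import Data.Unit using (⊤; tt)
open import Function using (_∘_; id)
open import Function.Bundles using (Equivalence)
open import Relation.Nullary using (¬_; Dec; yes; no)
open import Relation.Nullary.Decidable using (isYes; T?; toWitness; fromWitness)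
open import Relation.Binary.PropositionalEquality
  using (_≡_; refl; sym; trans; cong; cong₂; subst; module ≡-Reasoning)
open ≡-Reasoning

open DecMembership _≟_ using (_∈?_)
open Equivalence using (to; from)

private
  variable
    c : Bool
    α β : For₁
    Γ Γ′ Δ Δ′ L R : List For₁

weakenˡ : ∀ Γ′ → H c Γ Δ → H c (Γ′ ++ Γ) Δ
weakenˡ []       d = d
weakenˡ (γ ∷ Γ′) d = W⇒ γ (weakenˡ Γ′ d)

weakenʳ : ∀ Δ′ → H c Γ Δ → H c Γ (Δ′ ++ Δ)
weakenʳ []       d = d
weakenʳ (δ ∷ Δ′) d = ⇒W δ (weakenʳ Δ′ d)

weaken : Γ ⊆ Γ′ → Δ ⊆ Δ′ → H c Γ Δ → H c Γ′ Δ′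
weaken {Γ = Γ} {Γ′} {Δ} {Δ′} sΓ sΔ d =
  reprₛ (merge Γ′ sΓ , xs⊆xs++ys Γ′ Γ) (merge Δ′ sΔ , xs⊆xs++ys Δ′ Δ)
    (weakenˡ Γ′ (weakenʳ Δ′ d))
  where
  merge : ∀ {A : List For₁} B → A ⊆ B → B ++ A ⊆ B
  merge B s = [ id , s ] ∘ ∈-++⁻ B

identity : ∀ {φ} → φ ∈ Γ → φ ∈ Δ → H c Γ Δ
identity {φ = φ} φ∈Γ φ∈Δ =
  weaken (∈-∷⁺ʳ φ∈Γ (λ ())) (∈-∷⁺ʳ φ∈Δ (λ ())) (ax φ)

-- Adding a member again does not change the set; with weaken this collapses
-- a rule conclusion φ ∷ Γ to Γ when φ is already in Γ.
absorb : ∀ {φ} → φ ∈ Γ → φ ∷ Γ ⊆ Γ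
absorb φ∈Γ = ∈-∷⁺ʳ φ∈Γ ⊆-refl

toFront : ∀ {φ} (A B : List For₁) → A ++ φ ∷ B ⊆ φ ∷ A ++ B
toFront {φ} A B = ⊆-reflexive-↭ (shift φ A B)

fromFront : ∀ {φ} (A B : List For₁) → φ ∷ A ++ B ⊆ A ++ φ ∷ B
fromFront {φ} A B = ⊆-reflexive-↭ (↭-sym (shift φ A B))

var-∈ : ∀ {δ} → δ ∈ Δ → var δ ⊆ varSet Δ
var-∈ δ∈Δ p∈δ = ∈-concatMap⁺ var (lose δ∈Δ p∈δ)

_⊨_⇒_ : (For₁ → Set) → List For₁ → List For₁ → Set
I ⊨ Γ ⇒ Δ = All I Γ → Any I Δ

⊨-mono : ∀ {I} → Γ ⊆ Γ′ → Δ ⊆ Δ′ → I ⊨ Γ ⇒ Δ → I ⊨ Γ′ ⇒ Δ′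
⊨-mono sΓ sΔ h = Any-resp-⊆ sΔ ∘ h ∘ All-resp-⊇ sΓ

drop-false : ∀ {I : For₁ → Set} {φ} → ¬ I φ → Any I (φ ∷ Δ) → Any I Δ
drop-false ¬Iφ (here Iφ) = ⊥-elim (¬Iφ Iφ)
drop-false ¬Iφ (there IΔ) = IΔ

evB : (ℕ → Bool) → For₁ → Bool
evB v (pv p)   = v p
evB v (¬′ α)   = not (evB v α)
evB v (α ∨′ β) = evB v α ∨ evB v β

ClassicallyValid : List For₁ → List For₁ → Set
ClassicallyValid Γ Δ = ∀ v → (T ∘ evB v) ⊨ Γ ⇒ Δ

valid-mono : Γ ⊆ Γ′ → Δ ⊆ Δ′ →
             ClassicallyValid Γ Δ → ClassicallyValid Γ′ Δ′
valid-mono sΓ sΔ V v = ⊨-mono sΓ sΔ (V v)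

bool-cases : ∀ b → T b ⊎ T (not b)
bool-cases true  = inj₁ tt
bool-cases false = inj₂ tt

true-not-false : ∀ b → T b → ¬ T (not b)
true-not-false true _ ()

valid-¬L : ClassicallyValid (¬′ α ∷ Γ) Δ → ClassicallyValid Γ (α ∷ Δ)
valid-¬L {α} V v tΓ with bool-cases (evB v α)
... | inj₁ tα  = here tα
... | inj₂ t¬α = there (V v (t¬α ∷ tΓ))

valid-¬R : ClassicallyValid Γ (¬′ α ∷ Δ) → ClassicallyValid (α ∷ Γ) Δ
valid-¬R {α = α} V v (tα ∷ tΓ) = drop-false (true-not-false (evB v α) tα) (V v tΓ)

valid-∨L₁ : ClassicallyValid (α ∨′ β ∷ Γ) Δ → ClassicallyValid (α ∷ Γ) Δ
valid-∨L₁ V v (tα ∷ tΓ) = V v (T-∨ .from (inj₁ tα) ∷ tΓ)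

valid-∨L₂ : ClassicallyValid (α ∨′ β ∷ Γ) Δ → ClassicallyValid (β ∷ Γ) Δ
valid-∨L₂ V v (tβ ∷ tΓ) = V v (T-∨ .from (inj₂ tβ) ∷ tΓ)

valid-∨R : ClassicallyValid Γ (α ∨′ β ∷ Δ) → ClassicallyValid Γ (α ∷ β ∷ Δ)
valid-∨R V v tΓ with V v tΓ
... | here tαβ = [ here , there ∘ here ]′ (T-∨ .to tαβ)
... | there tΔ = there (there tΔ)

-- Weak Kleene truth values: just b is classical, nothing is "undefined".
-- Undefined is infectious, and in PWK it is designated.
V3 : Set
V3 = Maybe Bool

neg3 : V3 → V3
neg3 (just b) = just (not b)
neg3 nothing  = nothing

or3 : V3 → V3 → V3
or3 (just a) (just b) = just (a ∨ b)
or3 _        _        = nothing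

Designated : V3 → Set
Designated (just b) = T b
Designated nothing  = ⊤

designated? : ∀ x → Dec (Designated x)
designated? (just b) = T? b
designated? nothing  = yes tt

undefined-designated : ∀ {x} → x ≡ nothing → Designated x
undefined-designated refl = tt

neg3-designated : ∀ x → ¬ Designated x → Designated (neg3 x)
neg3-designated (just true)  ¬d = ¬d tt
neg3-designated (just false) ¬d = tt
neg3-designated nothing      ¬d = tt

neg3-designated⁻ : ∀ x → Designated (neg3 x) → x ≡ nothing ⊎ ¬ Designated x
neg3-designated⁻ (just true)  ()
neg3-designated⁻ (just false) _ = inj₂ id
neg3-designated⁻ nothing      _ = inj₁ refl

or3-designated⁻ : ∀ x y → Designated (or3 x y) → Designated x ⊎ Designated y
or3-designated⁻ (just a) (just b) d = T-∨ .to d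
or3-designated⁻ (just a) nothing  _ = inj₂ tt
or3-designated⁻ nothing  y        _ = inj₁ tt

or3-designatedˡ : ∀ x y → Designated x → Designated (or3 x y)
or3-designatedˡ (just a) (just b) d = T-∨ .from (inj₁ d)
or3-designatedˡ (just a) nothing  _ = tt
or3-designatedˡ nothing  y        _ = tt

or3-designatedʳ : ∀ x y → Designated y → Designated (or3 x y)
or3-designatedʳ (just a) (just b) d = T-∨ .from (inj₂ d)
or3-designatedʳ (just a) nothing  _ = tt
or3-designatedʳ nothing  y        _ = tt

ev : (ℕ → V3) → For₁ → V3
ev w (pv p)   = w p
ev w (¬′ α)   = neg3 (ev w α)
ev w (α ∨′ β) = or3 (ev w α) (ev w β)

PWKValid : List For₁ → List For₁ → Set
PWKValid Γ Δ = ∀ w → (Designated ∘ ev w) ⊨ Γ ⇒ Δ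

Undefined : (ℕ → V3) → ℕ → Set
Undefined w p = w p ≡ nothing

ev-undefined : ∀ w α → Any (Undefined w) (var α) → ev w α ≡ nothing
ev-undefined w (pv p)   (here u) = u
ev-undefined w (¬′ α)   u        = cong neg3 (ev-undefined w α u)
ev-undefined w (α ∨′ β) u with AnyP.++⁻ (var α) u
... | inj₁ uα = cong (λ x → or3 x (ev w β)) (ev-undefined w α uα)
... | inj₂ uβ = trans (cong (or3 (ev w α)) (ev-undefined w β uβ)) (or3-nothingʳ (ev w α))
  where
  or3-nothingʳ : ∀ x → or3 x nothing ≡ nothing
  or3-nothingʳ (just _) = refl
  or3-nothingʳ nothing  = refl

ev-undefined⁻ : ∀ w α → ev w α ≡ nothing → Any (Undefined w) (var α)
ev-undefined⁻ w (pv p)   u = here u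
ev-undefined⁻ w (¬′ α)   u with ev w α in eα
... | nothing = ev-undefined⁻ w α eα
ev-undefined⁻ w (α ∨′ β) u with ev w α in eα | ev w β in eβ
... | nothing | _       = AnyP.++⁺ˡ (ev-undefined⁻ w α eα)
... | just _  | nothing = AnyP.++⁺ʳ (var α) (ev-undefined⁻ w β eβ)

ev-classical : ∀ w v α → All (λ p → w p ≡ just (v p)) (var α) →
               ev w α ≡ just (evB v α)
ev-classical w v (pv p)   (e ∷ []) = e
ev-classical w v (¬′ α)   e = cong neg3 (ev-classical w v α e)
ev-classical w v (α ∨′ β) e =
  cong₂ or3 (ev-classical w v α (AllP.++⁻ˡ (var α) e))
            (ev-classical w v β (AllP.++⁻ʳ (var α) e))

-- For (¬H⇒) with ¬α designated, either α is false
-- and the premise applies, or α is undefined; then so is a variable of α,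
-- which by the variable condition infects some member of Δ.
sound : H c Γ Δ → PWKValid Γ Δ
sound (ax α) w (dα ∷ []) = here dα
sound (reprₛ (sΓ , _) (sΔ , _) d) w = ⊨-mono sΓ sΔ (sound d w)
sound (W⇒ α d) w (_ ∷ dΓ) = sound d w dΓ
sound (⇒W α d) w dΓ = there (sound d w dΓ)
sound (cut α _ _ d₁ d₂) w dΓ with designated? (ev w α)
... | yes dα = sound d₂ w (dα ∷ dΓ)
... | no ¬dα = drop-false ¬dα (sound d₁ w dΓ)
sound (⇒¬ α d) w dΓ with designated? (ev w α)
... | yes dα = there (sound d w (dα ∷ dΓ))
... | no ¬dα = here (neg3-designated (ev w α) ¬dα)
sound {Δ = Δ} (¬H⇒ α vars d) w (d¬α ∷ dΓ) with neg3-designated⁻ (ev w α) d¬α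
... | inj₂ ¬dα = drop-false ¬dα (sound d w dΓ)
... | inj₁ uα =
  Any.map (λ {δ} → undefined-designated ∘ ev-undefined w δ)
    (AnyP.concatMap⁻ var {xs = Δ} (Any-resp-⊆ vars (ev-undefined⁻ w α uα)))
sound (∨⇒ α β d₁ d₂) w (dαβ ∷ dΓ) with or3-designated⁻ (ev w α) (ev w β) dαβ
... | inj₁ dα = sound d₁ w (dα ∷ dΓ)
... | inj₂ dβ = sound d₂ w (dβ ∷ dΓ)
sound (⇒∨ α β d) w dΓ with sound d w dΓ
... | here dα = here (or3-designatedˡ (ev w α) (ev w β) dα)
... | there (here dβ) = here (or3-designatedʳ (ev w α) (ev w β) dβ)
... | there (there dΔ) = there dΔ

Bounded : List For₁ → For₁ → Set
Bounded Δ γ = All (_∈ varSet Δ) (var γ)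

bounded? : ∀ Δ γ → Dec (Bounded Δ γ)
bounded? Δ γ = all? (_∈? varSet Δ) (var γ)

bounded-varSet : All (Bounded Δ) Γ → varSet Γ ⊆ varSet Δ
bounded-varSet [] ()
bounded-varSet {Δ = Δ} {Γ = γ ∷ Γ} (b ∷ bs) p∈ with ∈-++⁻ (var γ) p∈
... | inj₁ p∈γ = All.lookup b p∈γ
... | inj₂ p∈Γ = bounded-varSet {Δ = Δ} bs p∈Γ

restrict : List For₁ → (ℕ → Bool) → ℕ → V3
restrict Δ v p with p ∈? varSet Δ
... | yes _ = just (v p)
... | no _  = nothing

restrict-inside : ∀ Δ v {p} → p ∈ varSet Δ → restrict Δ v p ≡ just (v p)
restrict-inside Δ v {p} p∈ with p ∈? varSet Δ
... | yes _ = refl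
... | no p∉ = ⊥-elim (p∉ p∈)

restrict-outside : ∀ Δ v {p} → p ∉ varSet Δ → restrict Δ v p ≡ nothing
restrict-outside Δ v {p} p∉ with p ∈? varSet Δ
... | yes p∈ = ⊥-elim (p∉ p∈)
... | no _   = refl

module _ (Δ : List For₁) (v : ℕ → Bool) where

  restrict-bounded : ∀ γ → Bounded Δ γ → ev (restrict Δ v) γ ≡ just (evB v γ)
  restrict-bounded γ b = ev-classical (restrict Δ v) v γ (All.map (restrict-inside Δ v) b)

  restrict-designated : ∀ Γ → All (T ∘ evB v) (filter (bounded? Δ) Γ) →
                        All (Designated ∘ ev (restrict Δ v)) Γ
  restrict-designated []      _ = []
  restrict-designated (γ ∷ Γ) t with bounded? Δ γ
  ... | yes b = subst Designated (sym (restrict-bounded γ b)) (All.head t)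
                ∷ restrict-designated Γ (All.tail t)
  ... | no ¬b = undefined-designated (ev-undefined _ γ outside) ∷ restrict-designated Γ t
    where
    outside : Any (Undefined (restrict Δ v)) (var γ)
    outside = Any.map (restrict-outside Δ v) (AllP.¬All⇒Any¬ (_∈? varSet Δ) (var γ) ¬b)

restriction : ∀ Γ Δ → PWKValid Γ Δ → ClassicallyValid (filter (bounded? Δ) Γ) Δ
restriction Γ Δ V v tΓ′ =
  let δ , δ∈Δ , dδ = find (V (restrict Δ v) (restrict-designated Δ v Γ tΓ′))
  in lose δ∈Δ (subst Designated (restrict-bounded Δ v δ (All.tabulate (var-∈ δ∈Δ))) dδ)

atoms : List ℕ → List For₁
atoms = map pv

-- A classically valid atomic sequent shares an atom on both sides: otherwise
-- making exactly the antecedent atoms true refutes it.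
atomic-overlap : ∀ ga da → ClassicallyValid (atoms ga) (atoms da) →
                 ∃[ p ] p ∈ da × p ∈ ga
atomic-overlap ga da V =
  find (Any.map toWitness (AnyP.map⁻ (V v (AllP.map⁺ (All.tabulate fromWitness)))))
  where
  v : ℕ → Bool
  v p = isYes (p ∈? ga)

-- The measure of proof search: the number of symbols left to decompose.
size : For₁ → ℕ
size (pv _)   = 1
size (¬′ α)   = suc (size α)
size (α ∨′ β) = suc (size α + size β)

sizes : List For₁ → ℕ
sizes []      = 0
sizes (φ ∷ Γ) = size φ + sizes Γ

-- Arithmetic of the left rules: (¬H⇒) moves α across, (∨⇒) shrinks α ∨ β.
measure-¬L : ∀ a g d → g + (a + d) ≡ (a + g) + d
measure-¬L a g d = begin
  g + (a + d) ≡⟨ +-assoc g a d ⟨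
  (g + a) + d ≡⟨ cong (_+ d) (+-comm g a) ⟩
  (a + g) + d ∎

measure-∨L : ∀ {k} a b g d → k ≤ a + b → (k + g) + d ≤ ((a + b) + g) + d
measure-∨L a b g d k≤ = +-monoˡ-≤ d (+-monoˡ-≤ g k≤)

-- The
-- sequent being searched consists of formulas Γ, Δ still to be decomposed
-- and atoms ga, da already reached; the search proves every L ⇒ R containing
-- them.  Principal formulas are kept in L ⇒ R (sequents are sets), so the
-- invariant var(Γ) ⊆ var(R) survives each step and licenses (¬H⇒).
complete : ∀ n ga da Γ Δ → sizes Γ + sizes Δ < n →
           ClassicallyValid (Γ ++ atoms ga) (Δ ++ atoms da) →
           Γ ++ atoms ga ⊆ L → Δ ++ atoms da ⊆ R → varSet Γ ⊆ varSet R →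
           CutFree L R
complete zero ga da Γ Δ ()
complete (suc n) ga da [] [] _ V sL sR _ =
  let p , p∈da , p∈ga = atomic-overlap ga da V
  in identity (sL (∈-map⁺ pv p∈ga)) (sR (∈-map⁺ pv p∈da))
complete (suc n) ga da (pv p ∷ Γ) Δ (s≤s m) V sL sR vars =
  complete n (p ∷ ga) da Γ Δ m (valid-mono (fromFront Γ (atoms ga)) ⊆-refl V)
    (sL ∘ toFront Γ (atoms ga)) sR (vars ∘ there)
complete (suc n) ga da (¬′ α ∷ Γ) Δ (s≤s m) V sL sR vars =
  weaken (absorb (sL (here refl))) ⊆-refl
    (¬H⇒ α (vars ∘ ∈-++⁺ˡ)
      (complete n ga da Γ (α ∷ Δ) m′ (valid-¬L V) (sL ∘ there) (∷⁺ʳ α sR)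
        (∈-++⁺ʳ (var α) ∘ vars ∘ ∈-++⁺ʳ (var α))))
  where
  m′ : sizes Γ + (size α + sizes Δ) < n
  m′ = ≤-<-trans (≤-reflexive (measure-¬L (size α) (sizes Γ) (sizes Δ))) m
complete (suc n) ga da (α ∨′ β ∷ Γ) Δ (s≤s m) V sL sR vars =
  weaken (absorb (sL (here refl))) ⊆-refl
    (∨⇒ α β
      (complete n ga da (α ∷ Γ) Δ (≤-<-trans (shrink (m≤m+n (size α) (size β))) m)
        (valid-∨L₁ V) (∷⁺ʳ α (sL ∘ there)) sR
        (vars ∘ ++⁺ˡ (varSet Γ) (xs⊆xs++ys (var α) (var β))))
      (complete n ga da (β ∷ Γ) Δ (≤-<-trans (shrink (m≤n+m (size β) (size α))) m)
        (valid-∨L₂ V) (∷⁺ʳ β (sL ∘ there)) sR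
        (vars ∘ ++⁺ˡ (varSet Γ) (xs⊆ys++xs (var β) (var α)))))
  where
  shrink : ∀ {k} → k ≤ size α + size β →
           (k + sizes Γ) + sizes Δ ≤ ((size α + size β) + sizes Γ) + sizes Δ
  shrink = measure-∨L (size α) (size β) (sizes Γ) (sizes Δ)
complete (suc n) ga da [] (pv p ∷ Δ) (s≤s m) V sL sR _ =
  complete n ga (p ∷ da) [] Δ m (valid-mono ⊆-refl (fromFront Δ (atoms da)) V)
    sL (sR ∘ toFront Δ (atoms da)) (λ ())
complete (suc n) ga da [] (¬′ α ∷ Δ) (s≤s m) V sL sR _ =
  weaken ⊆-refl (absorb (sR (here refl)))
    (⇒¬ α (complete n ga da (α ∷ []) Δ m′ (valid-¬R V) (∷⁺ʳ α sL) (sR ∘ there)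
      (var-∈ (sR (here refl)) ∘ ⊆-reflexive (++-identityʳ (var α)))))
  where
  m′ : (size α + 0) + sizes Δ < n
  m′ = ≤-<-trans (≤-reflexive (cong (_+ sizes Δ) (+-identityʳ (size α)))) m
complete (suc n) ga da [] (α ∨′ β ∷ Δ) (s≤s m) V sL sR _ =
  weaken ⊆-refl (absorb (sR (here refl)))
    (⇒∨ α β (complete n ga da [] (α ∷ β ∷ Δ) m′ (valid-∨R V) sL
      (∷⁺ʳ α (∷⁺ʳ β (sR ∘ there))) (λ ())))
  where
  m′ : size α + (size β + sizes Δ) < n
  m′ = ≤-<-trans (≤-reflexive (sym (+-assoc (size α) (size β) (sizes Δ)))) m

completeness : ClassicallyValid Γ Δ → Γ ⊆ L → Δ ⊆ R → varSet Γ ⊆ varSet R →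
               CutFree L R
completeness {Γ = Γ} {Δ = Δ} V sL sR vars =
  complete (suc (sizes Γ + sizes Δ)) [] [] Γ Δ ≤-refl
    (valid-mono (xs⊆xs++ys Γ []) (xs⊆xs++ys Δ []) V)
    (sL ∘ ⊆-reflexive (++-identityʳ Γ)) (sR ∘ ⊆-reflexive (++-identityʳ Δ)) vars

mainTheorem3 : (Γ Δ : List For₁) → NonEmptySeq Γ Δ → Provable Γ Δ → CutFree Γ Δ
mainTheorem3 Γ Δ _ d =
  completeness (restriction Γ Δ (sound d)) (filter-⊆ (bounded? Δ) Γ) ⊆-refl
    (bounded-varSet {Δ = Δ} (AllP.all-filter (bounded? Δ) Γ))
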